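{- Let $\mathbb{I}$ be an interval satisfying the Phoa principle. Then for any $i:\mathbb{I}$, every function $\alpha\colon\mathbb{I}/i\to\mathbb{I}$ is monotone, and the embedding $\{0,i\}\hookrightarrow\mathbb{I}/i$ is an $\mathbb{I}$-epimorphism: any two functions $\alpha,\beta\colon\mathbb{I}/i\to\mathbb{I}$ with $\alpha(0)=\beta(0)$ and $\alpha(i)=\beta(i)$ are equal.
   Context: Homotopy type theory. An interval is a set $\mathbb{I}$ with bounded meet-semilattice structure $(0,1,\sqcap)$, $i\sqsubseteq j$ meaning $i\sqcap j=i$. $\mathbb{I}/i:\equiv\{j:\mathbb{I}\mid j\sqsubseteq i\}$ with the induced order. Phoa principle: every function $\alpha\colon\mathbb{I}\to\mathbb{I}$ is monotone, and any $\alpha,\beta\colon\mathbb{I}\to\mathbb{I}$ with $\alpha(0)=\beta(0)$ and $\alpha(1)=\beta(1)$ are equal. A map $f\colon A\to B$ is an $R$-epimorphism if $R^f\colon R^B\to R^A$ is an embedding. -}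

module Defs where

open import Level using (Level; suc)
open import Data.Product using (Σ; _×_; _,_)
open import Relation.Binary.PropositionalEquality using (_≡_)

IsSet : ∀ {ℓ} → Set ℓ → Set ℓ
IsSet A = ∀ {x y : A} (p q : x ≡ y) → p ≡ q

record Interval ℓ : Set (suc ℓ) where
  infixr 7 _⊓_
  infix 4 _⊑_
  field
    Carrier  : Set ℓ
    isSet    : IsSet Carrier
    𝟘 𝟙      : Carrier
    _⊓_      : Carrier → Carrier → Carrier
    ⊓-assoc  : ∀ x y z → (x ⊓ y) ⊓ z ≡ x ⊓ (y ⊓ z)
    ⊓-comm   : ∀ x y → x ⊓ y ≡ y ⊓ x
    ⊓-idem   : ∀ x → x ⊓ x ≡ x
    𝟘-zeroˡ  : ∀ x → 𝟘 ⊓ x ≡ 𝟘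
    𝟙-identityˡ : ∀ x → 𝟙 ⊓ x ≡ x

  _⊑_ : Carrier → Carrier → Set ℓ
  i ⊑ j = i ⊓ j ≡ i

  Slice : Carrier → Set ℓ
  Slice i = Σ Carrier (λ j → j ⊑ i)

  _⊑/_ : ∀ {i} → Slice i → Slice i → Set ℓ
  (j , _) ⊑/ (k , _) = j ⊑ k

  𝟘/ : (i : Carrier) → Slice i
  𝟘/ i = 𝟘 , 𝟘-zeroˡ i

  top/ : (i : Carrier) → Slice i
  top/ i = i , ⊓-idem i

  -- Phoa principle (function equality stated pointwise)
  Phoa : Set ℓ
  Phoa = (∀ (α : Carrier → Carrier) {j k} → j ⊑ k → α j ⊑ α k)
       × (∀ (α β : Carrier → Carrier) → α 𝟘 ≡ β 𝟘 → α 𝟙 ≡ β 𝟙 → ∀ x → α x ≡ β x)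

{-# OPTIONS --safe #-}
module Submission where

-- The slice 𝕀/i is a retract of 𝕀 via x ↦ x ⊓ i, a retraction sending 0 and 1 to
-- 0 and i. Precomposing a function on 𝕀/i with it gives a function on 𝕀 to which
-- the Phoa principle applies, and the section 𝕀/i ↪ 𝕀 carries the conclusions back.

open import Defs
open import Data.Product using (_×_; _,_; proj₁)
open import Function using (_∘_)
open import Relation.Binary.PropositionalEquality
  using (_≡_; refl; sym; trans; cong; subst; subst₂; module ≡-Reasoning)

module _ {ℓ} (𝕀 : Interval ℓ) where
  open Interval 𝕀

  Slice-≡ : ∀ {i} {s t : Slice i} → proj₁ s ≡ proj₁ t → s ≡ t
  Slice-≡ {s = j , p} {t = .j , q} refl = cong (j ,_) (isSet p q)

  x⊓y⊑y : ∀ x y → x ⊓ y ⊑ y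
  x⊓y⊑y x y = trans (⊓-assoc x y y) (cong (x ⊓_) (⊓-idem y))

  restrict : (i : Carrier) → Carrier → Slice i
  restrict i x = x ⊓ i , x⊓y⊑y x i

  restrict-proj₁ : ∀ {i} (s : Slice i) → restrict i (proj₁ s) ≡ s
  restrict-proj₁ (j , j⊑i) = Slice-≡ j⊑i

  restrict-𝟘 : ∀ i → restrict i 𝟘 ≡ 𝟘/ i
  restrict-𝟘 i = Slice-≡ (𝟘-zeroˡ i)

  restrict-𝟙 : ∀ i → restrict i 𝟙 ≡ top/ i
  restrict-𝟙 i = Slice-≡ (𝟙-identityˡ i)

  slice-monotone : (∀ (α : Carrier → Carrier) {j k} → j ⊑ k → α j ⊑ α k) →
                   ∀ i (α : Slice i → Carrier) {j k : Slice i} → j ⊑/ k → α j ⊑ α k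
  slice-monotone mono i α {j} {k} j⊑k =
    subst₂ (λ s t → α s ⊑ α t) (restrict-proj₁ j) (restrict-proj₁ k)
      (mono (α ∘ restrict i) j⊑k)

  slice-ext : (∀ (α β : Carrier → Carrier) → α 𝟘 ≡ β 𝟘 → α 𝟙 ≡ β 𝟙 → ∀ x → α x ≡ β x) →
              ∀ i (α β : Slice i → Carrier) →
              α (𝟘/ i) ≡ β (𝟘/ i) → α (top/ i) ≡ β (top/ i) → ∀ x → α x ≡ β x
  slice-ext ext i α β α0≡β0 αi≡βi x = begin
    α x                       ≡⟨ cong α (restrict-proj₁ x) ⟨
    α (restrict i (proj₁ x))  ≡⟨ ext (α ∘ restrict i) (β ∘ restrict i) at-𝟘 at-𝟙 (proj₁ x) ⟩
    β (restrict i (proj₁ x))  ≡⟨ cong β (restrict-proj₁ x) ⟩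
    β x                       ∎
    where
    open ≡-Reasoning
    at-𝟘 : α (restrict i 𝟘) ≡ β (restrict i 𝟘)
    at-𝟘 = subst (λ s → α s ≡ β s) (sym (restrict-𝟘 i)) α0≡β0
    at-𝟙 : α (restrict i 𝟙) ≡ β (restrict i 𝟙)
    at-𝟙 = subst (λ s → α s ≡ β s) (sym (restrict-𝟙 i)) αi≡βi

lemmaV4 : ∀ {ℓ} (𝕀 : Interval ℓ) → Interval.Phoa 𝕀 → (i : Interval.Carrier 𝕀) →
    let open Interval 𝕀 in
      (∀ (α : Slice i → Carrier) {j k : Slice i} → j ⊑/ k → α j ⊑ α k)
    × (∀ (α β : Slice i → Carrier) → α (𝟘/ i) ≡ β (𝟘/ i) → α (top/ i) ≡ β (top/ i) → ∀ x → α x ≡ β x)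
lemmaV4 𝕀 (mono , ext) i = slice-monotone 𝕀 mono i , slice-ext 𝕀 ext i
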